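{- Let $G$ be a connected graph of order at least $3$. Then $\mathrm{sd}(G)=1$ if and only if $\mathrm{msd}(G)=1$.
   Context: Graphs are finite and simple. $\gamma(G)$ is the domination number (minimum size of a set $D$ such that every vertex outside $D$ has a neighbour in $D$). $\mathrm{sd}(G)$ is the minimum number of edges that must be subdivided, each at most once, to increase $\gamma$. For an edge $e=uv$ and $t\ge1$, $G_{e,t}$ is obtained by replacing $e$ by a path with $t$ new internal vertices; $\mathrm{msd}(uv)$ is the least positive $t$ with $\gamma(G_{uv,t})>\gamma(G)$, and $\mathrm{msd}(G)=\min_{uv\in E(G)}\mathrm{msd}(uv)$. -}

module Defs where

open import Data.Nat using (ℕ; zero; suc; _+_; _≤_; _<_)
open import Data.Fin using (Fin; toℕ; splitAt)
open import Data.Fin.Subset using (Subset; _∈_; ∣_∣)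
open import Data.Product using (Σ; ∃; ∃-syntax; _×_; _,_; proj₁; proj₂)
open import Data.Sum using (_⊎_; inj₁; inj₂)
open import Data.Empty using (⊥)
open import Data.List using (List; length; lookup)
open import Data.List.Relation.Unary.All using (All)
open import Data.List.Relation.Unary.Any using (Any)
open import Relation.Nullary using (¬_)
open import Relation.Binary.PropositionalEquality using (_≡_)

record Graph (n : ℕ) : Set₁ where
  field
    Adj    : Fin n → Fin n → Set
    sym    : ∀ {u v} → Adj u v → Adj v u
    irrefl : ∀ {u} → ¬ Adj u u
open Graph public

data Walk {n : ℕ} (G : Graph n) : Fin n → Fin n → Set where
  here : ∀ {u} → Walk G u u
  step : ∀ {u v w} → Adj G u v → Walk G v w → Walk G u w

Connected : ∀ {n} → Graph n → Set
Connected G = ∀ u v → Walk G u v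

Dominating : ∀ {m} → (Fin m → Fin m → Set) → Subset m → Set
Dominating {m} A D = ∀ (x : Fin m) → x ∈ D ⊎ (∃[ y ] (y ∈ D × A x y))

IsDomNum : ∀ {m} → (Fin m → Fin m → Set) → ℕ → Set
IsDomNum {m} A k =
  (∃[ D ] (Dominating A D × ∣ D ∣ ≡ k)) ×
  (∀ (D : Subset m) → Dominating A D → k ≤ ∣ D ∣)

DomIncreases : ∀ {m m'} → (Fin m → Fin m → Set) → (Fin m' → Fin m' → Set) → Set
DomIncreases A B = ∀ k k' → IsDomNum A k → IsDomNum B k' → k < k'

SameEdge : ∀ {n} → Fin n → Fin n → Fin n → Fin n → Set
SameEdge x y u v = (x ≡ u × y ≡ v) ⊎ (x ≡ v × y ≡ u)

-- Subdividing a set F of edges, each once.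
-- F is a list of edges (ordered pairs of adjacent vertices), no edge listed twice.
-- New vertex i (i < length F) subdivides the i-th edge of F.

EdgeIn : ∀ {n} → Fin n → Fin n → List (Fin n × Fin n) → Set
EdgeIn x y F = Any (λ e → SameEdge x y (proj₁ e) (proj₂ e)) F

data ValidEdgeSet {n : ℕ} (G : Graph n) : List (Fin n × Fin n) → Set where
  []  : ValidEdgeSet G Data.List.[]
  _∷_ : ∀ {u v F} → (Adj G u v × ¬ EdgeIn u v F) → ValidEdgeSet G F →
        ValidEdgeSet G (Data.List._∷_ (u , v) F)

SubAdj : ∀ {n} → Graph n → (F : List (Fin n × Fin n)) →
         Fin (n + length F) → Fin (n + length F) → Set
SubAdj {n} G F a b with splitAt n a | splitAt n b
... | inj₁ x | inj₁ y = Adj G x y × ¬ EdgeIn x y F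
... | inj₁ x | inj₂ i = x ≡ proj₁ (lookup F i) ⊎ x ≡ proj₂ (lookup F i)
... | inj₂ i | inj₁ x = x ≡ proj₁ (lookup F i) ⊎ x ≡ proj₂ (lookup F i)
... | inj₂ i | inj₂ j = ⊥

IsSd : ∀ {n} → Graph n → ℕ → Set
IsSd G k =
  (∃[ F ] (ValidEdgeSet G F × length F ≡ k × DomIncreases (Adj G) (SubAdj G F))) ×
  (∀ F → ValidEdgeSet G F → DomIncreases (Adj G) (SubAdj G F) → k ≤ length F)

-- G_{uv,t}: replace edge uv by a path u - p₀ - p₁ - ... - p_{t-1} - v

PathSubAdj : ∀ {n} → Graph n → Fin n → Fin n → (t : ℕ) →
             Fin (n + t) → Fin (n + t) → Set
PathSubAdj {n} G u v t a b with splitAt n a | splitAt n b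
... | inj₁ x | inj₁ y = Adj G x y × ¬ SameEdge x y u v
... | inj₁ x | inj₂ i = (x ≡ u × toℕ i ≡ 0) ⊎ (x ≡ v × suc (toℕ i) ≡ t)
... | inj₂ i | inj₁ x = (x ≡ u × toℕ i ≡ 0) ⊎ (x ≡ v × suc (toℕ i) ≡ t)
... | inj₂ i | inj₂ j = (suc (toℕ i) ≡ toℕ j) ⊎ (suc (toℕ j) ≡ toℕ i)

IsMsdEdge : ∀ {n} → Graph n → Fin n → Fin n → ℕ → Set
IsMsdEdge G u v t =
  (1 ≤ t × DomIncreases (Adj G) (PathSubAdj G u v t)) ×
  (∀ s → 1 ≤ s → DomIncreases (Adj G) (PathSubAdj G u v s) → t ≤ s)

IsMsd : ∀ {n} → Graph n → ℕ → Set
IsMsd {n} G m =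
  (∃[ u ] ∃[ v ] (Adj G u v × IsMsdEdge G u v m)) ×
  (∀ (u v : Fin n) → Adj G u v → ∀ s → IsMsdEdge G u v s → m ≤ s)

-- Subdividing a single edge uv once yields exactly G_{uv,1}, so sd(G) = 1 and
-- msd(G) = 1 both say that some one-vertex subdivision increases γ.  The only
-- further point is that sd(G) ≠ 0: subdividing no edge returns G itself, and
-- γ(G) cannot exceed itself.  As γ is only characterised relationally, its
-- existence is used under a double negation, which suffices to refute
-- DomIncreases.
module Submission where

open import Defs hiding (sym)
open import Data.Nat using (ℕ; suc; _+_; _≤_; z≤n; s≤s; _≤?_)
open import Data.Nat.Properties using (≤-refl; ≤-trans; ≤-pred; ≰⇒>; <⇒≱; +-identityʳ)
open import Data.Fin using (Fin; zero; toℕ; splitAt; _↑ˡ_)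
open import Data.Fin.Properties using (toℕ-injective; toℕ-↑ˡ; splitAt-↑ˡ; subst-is-cast; toℕ-cast)
open import Data.Fin.Subset using (∣_∣; ⊤)
open import Data.Fin.Subset.Properties using (∈⊤)
open import Data.Product using (∃; _,_; proj₁; proj₂)
open import Data.Sum using (inj₁; inj₂; [_,_])
import Data.Sum as Sum
open import Data.Empty using (⊥-elim)
open import Data.List using ([]; _∷_; length)
open import Data.List.Relation.Unary.Any using (here; there)
open import Function.Bundles using (_⇔_; mk⇔)
open import Relation.Nullary using (¬_; yes; no)
open import Relation.Binary.PropositionalEquality using (_≡_; refl; sym; trans; cong; subst; module ≡-Reasoning)

Dominating-mono : ∀ {m} {A B : Fin m → Fin m → Set} → (∀ a b → A a b → B a b) →
                  ∀ D → Dominating A D → Dominating B D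
Dominating-mono A⇒B D dom x with dom x
... | inj₁ x∈D           = inj₁ x∈D
... | inj₂ (y , y∈D , a) = inj₂ (y , y∈D , A⇒B x y a)

IsDomNum-cong : ∀ {m} {A B : Fin m → Fin m → Set} →
                (∀ a b → A a b → B a b) → (∀ a b → B a b → A a b) →
                ∀ k → IsDomNum A k → IsDomNum B k
IsDomNum-cong A⇒B B⇒A k ((D , dom , ∣D∣≡k) , minimal) =
  (D , Dominating-mono A⇒B D dom , ∣D∣≡k) ,
  λ D′ dom′ → minimal D′ (Dominating-mono B⇒A D′ dom′)

DomIncreases-congʳ : ∀ {m m′} {A : Fin m → Fin m → Set} {B B′ : Fin m′ → Fin m′ → Set} →
                     (∀ a b → B a b → B′ a b) → (∀ a b → B′ a b → B a b) →
                     DomIncreases A B → DomIncreases A B′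
DomIncreases-congʳ B⇒B′ B′⇒B inc k k′ γA γB′ = inc k k′ γA (IsDomNum-cong B′⇒B B⇒B′ k′ γB′)

module _ {m : ℕ} (A : Fin m → Fin m → Set) where

  -- Induction on a bound for |D|: either D is a minimum, or a strictly smaller
  -- dominating set exists and the bound drops.
  ¬¬domNum-below : ∀ b D → Dominating A D → ∣ D ∣ ≤ b → ¬ ¬ ∃ (IsDomNum A)
  ¬¬domNum-below b D dom ∣D∣≤b ¬γ = ¬γ (∣ D ∣ , (D , dom , refl) , minimum ∣D∣≤b)
    where
    minimum : ∀ {b} → ∣ D ∣ ≤ b → ∀ D′ → Dominating A D′ → ∣ D ∣ ≤ ∣ D′ ∣
    minimum {b} ∣D∣≤b D′ dom′ with ∣ D ∣ ≤? ∣ D′ ∣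
    ... | yes ∣D∣≤∣D′∣ = ∣D∣≤∣D′∣
    ... | no ∣D∣≰∣D′∣ with b | ≤-trans (≰⇒> ∣D∣≰∣D′∣) ∣D∣≤b
    ...   | suc b′ | ∣D′∣<b = ⊥-elim (¬¬domNum-below b′ D′ dom′ (≤-pred ∣D′∣<b) ¬γ)

  ¬¬domNum : ¬ ¬ ∃ (IsDomNum A)
  ¬¬domNum = ¬¬domNum-below ∣ ⊤ {m} ∣ ⊤ (λ x → inj₁ ∈⊤) ≤-refl

¬DomIncreases-⊆ : ∀ {m} {A B : Fin m → Fin m → Set} →
                  (∀ a b → A a b → B a b) → ¬ DomIncreases A B
¬DomIncreases-⊆ {A = A} {B} A⇒B inc =
  ¬¬domNum A λ { (k , γA@((D , dom , refl) , _)) →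
  ¬¬domNum B λ { (k′ , γB@(_ , minimalB)) →
    <⇒≱ (inc k k′ γA γB) (minimalB D (Dominating-mono A⇒B D dom)) } }

¬DomIncreases-subst : ∀ {m m′} (eq : m ≡ m′) {A : Fin m → Fin m → Set} {B : Fin m′ → Fin m′ → Set} →
                      (∀ a b → A a b → B (subst Fin eq a) (subst Fin eq b)) → ¬ DomIncreases A B
¬DomIncreases-subst refl = ¬DomIncreases-⊆

splitAt-subst-+0 : ∀ n (a : Fin n) → splitAt n (subst Fin (sym (+-identityʳ n)) a) ≡ inj₁ a
splitAt-subst-+0 n a = begin
  splitAt n (subst Fin eq a)  ≡⟨ cong (splitAt n) (toℕ-injective toℕ-agree) ⟩
  splitAt n (a ↑ˡ 0)          ≡⟨ splitAt-↑ˡ n a 0 ⟩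
  inj₁ a                      ∎
  where
  open ≡-Reasoning
  eq : n ≡ n + 0
  eq = sym (+-identityʳ n)
  toℕ-agree : toℕ (subst Fin eq a) ≡ toℕ (a ↑ˡ 0)
  toℕ-agree = trans (cong toℕ (subst-is-cast eq a))
                    (trans (toℕ-cast eq a) (sym (toℕ-↑ˡ a 0)))

Adj⇒SubAdj[] : ∀ {n} (G : Graph n) a b → Adj G a b →
               SubAdj G [] (subst Fin (sym (+-identityʳ n)) a) (subst Fin (sym (+-identityʳ n)) b)
Adj⇒SubAdj[] {n} G a b adj
  rewrite splitAt-subst-+0 n a | splitAt-subst-+0 n b = adj , λ ()

¬DomIncreases-SubAdj[] : ∀ {n} (G : Graph n) → ¬ DomIncreases (Adj G) (SubAdj G [])
¬DomIncreases-SubAdj[] {n} G = ¬DomIncreases-subst (sym (+-identityʳ n)) (Adj⇒SubAdj[] G)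

SubAdj-single⇒PathSubAdj₁ : ∀ {n} (G : Graph n) u v a b →
                            SubAdj G ((u , v) ∷ []) a b → PathSubAdj G u v 1 a b
SubAdj-single⇒PathSubAdj₁ {n} G u v a b adj with splitAt n a | splitAt n b
... | inj₁ x    | inj₁ y    = proj₁ adj , λ xy≡uv → proj₂ adj (here xy≡uv)
... | inj₁ x    | inj₂ zero = Sum.map (_, refl) (_, refl) adj
... | inj₂ zero | inj₁ x    = Sum.map (_, refl) (_, refl) adj

PathSubAdj₁⇒SubAdj-single : ∀ {n} (G : Graph n) u v a b →
                            PathSubAdj G u v 1 a b → SubAdj G ((u , v) ∷ []) a b
PathSubAdj₁⇒SubAdj-single {n} G u v a b adj with splitAt n a | splitAt n b
... | inj₁ x    | inj₁ y    = proj₁ adj , λ { (here xy≡uv) → proj₂ adj xy≡uv ; (there ()) }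
... | inj₁ x    | inj₂ zero = Sum.map proj₁ proj₁ adj
... | inj₂ zero | inj₁ x    = Sum.map proj₁ proj₁ adj
... | inj₂ zero | inj₂ zero = [ (λ ()) , (λ ()) ] adj

IsSd-1⇒IsMsd-1 : ∀ {n} (G : Graph n) → IsSd G 1 → IsMsd G 1
IsSd-1⇒IsMsd-1 G ((((u , v) ∷ []) , ((adj , _) ∷ []) , refl , inc) , _) =
  (u , v , adj , (s≤s z≤n , incPath) , λ s 1≤s _ → 1≤s) ,
  λ _ _ _ s msd → proj₁ (proj₁ msd)
  where
  incPath : DomIncreases (Adj G) (PathSubAdj G u v 1)
  incPath = DomIncreases-congʳ (SubAdj-single⇒PathSubAdj₁ G u v)
                               (PathSubAdj₁⇒SubAdj-single G u v) inc

IsMsd-1⇒IsSd-1 : ∀ {n} (G : Graph n) → IsMsd G 1 → IsSd G 1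
IsMsd-1⇒IsSd-1 G ((u , v , adj , (_ , inc) , _) , _) =
  (((u , v) ∷ []) , ((adj , λ ()) ∷ []) , refl , incSingle) , atLeastOne
  where
  incSingle : DomIncreases (Adj G) (SubAdj G ((u , v) ∷ []))
  incSingle = DomIncreases-congʳ (PathSubAdj₁⇒SubAdj-single G u v)
                                 (SubAdj-single⇒PathSubAdj₁ G u v) inc
  atLeastOne : ∀ F → ValidEdgeSet G F → DomIncreases (Adj G) (SubAdj G F) → 1 ≤ length F
  atLeastOne []      _ inc[] = ⊥-elim (¬DomIncreases-SubAdj[] G inc[])
  atLeastOne (_ ∷ _) _ _     = s≤s z≤n

mainTheorem3 : ∀ {n : ℕ} (G : Graph n) → 3 ≤ n → Connected G →
    IsSd G 1 ⇔ IsMsd G 1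
mainTheorem3 G _ _ = mk⇔ (IsSd-1⇒IsMsd-1 G) (IsMsd-1⇒IsSd-1 G)
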